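{- Let $q=p^s$ with $p$ an odd prime, let $d>1$ with $q\equiv1\pmod{2d}$, and let $N=\omega(GP(q,d))$. If an integer $n$ with $2\le n\le N$ satisfies $\binom{n-1+\frac{q-1}{d}}{\frac{q-1}{d}}\not\equiv0\pmod p$, then $(N-1)n\le\frac{q-1}{d}$.
   Context: For $d>1$ and $q\equiv1\pmod{2d}$, $GP(q,d)$ is the graph on $\mathbb{F}_q$ where distinct $x,y$ are adjacent iff $x-y=z^d$ for some $z\in\mathbb{F}_q$; $\omega$ denotes clique number. -}

module Defs where

open import Level using (0ℓ)
open import Data.Nat using (ℕ; zero; suc; _≤_)
open import Data.Fin using (Fin)
open import Data.Product using (Σ; ∃; _×_)
open import Relation.Nullary using (¬_)
open import Relation.Binary.PropositionalEquality using (_≡_; _≢_)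
open import Algebra.Bundles using (CommutativeRing)

record FiniteField (q : ℕ) : Set₁ where
  field
    commRing : CommutativeRing 0ℓ 0ℓ
  open CommutativeRing commRing public
  field
    1≉0     : ¬ (1# ≈ 0#)
    inverse : ∀ x → ¬ (x ≈ 0#) → ∃ λ y → (x * y) ≈ 1#
    enum    : Fin q → Carrier
    enum-injective  : ∀ i j → enum i ≈ enum j → i ≡ j
    enum-surjective : ∀ x → ∃ λ i → enum i ≈ x

module _ {q : ℕ} (F : FiniteField q) where
  open FiniteField F

  pow : Carrier → ℕ → Carrier
  pow x zero    = 1#
  pow x (suc n) = x * pow x n

  GPAdj : ℕ → Carrier → Carrier → Set
  GPAdj d x y = ¬ (x ≈ y) × ∃ λ z → (x - y) ≈ pow z d

  IsClique : ℕ → (k : ℕ) → (Fin k → Carrier) → Set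
  IsClique d k v = ∀ i j → i ≢ j → GPAdj d (v i) (v j)

  IsCliqueNumber : ℕ → ℕ → Set
  IsCliqueNumber d N =
    (Σ (Fin N → Carrier) λ v → IsClique d N v) ×
    (∀ k (v : Fin k → Carrier) → IsClique d k v → k ≤ N)

module Submission where

-- Stepanov's method. Let n = L + 1 ≤ N, m = (q - 1)/d, let a₀, …, a_L be vertices of a clique
-- v₁, …, v_N, and let wᵢ be the divided-difference weights of the aᵢ. The polynomial
-- f(x) = ∑ᵢ wᵢ (x + aᵢ) ^ (L + m) - 1 has degree m, its leading coefficient being the binomial
-- coefficient (L + m choose m), nonzero mod p. Each u = aᵢ - vₖ is 0 or a d-th power, so u ^ m is
-- 0 or 1 and u ^ (L + m - j) = u ^ (L - j); hence the Hasse derivatives of f at -vₖ vanish up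
-- to order L, and up to order L + 1 when vₖ is not a node. Counting roots with multiplicity,
-- L n + (L + 1)(N - n) = (N - 1) n ≤ m.

open import Defs
open import Level using (0ℓ; _⊔_)
open import Algebra.Bundles using (CommutativeRing; CommutativeMonoid)
open import Data.Empty using (⊥-elim)
open import Data.Fin as Fin using (Fin; zero; suc)
open import Data.Fin.Permutation using (Permutation; permutation)
open import Data.Fin.Properties using (suc-injective; punchInᵢ≢i; toℕ<n; toℕ-inject≤; inject≤-injective)
open import Data.List using (List; []; _∷_; drop; map)
open import Data.Nat as ℕ using (ℕ; zero; suc; z≤n; s≤s; _≤_; _<_; _∸_; NonZero)
import Data.Nat.Properties as ℕ
open import Algebra.Properties.Monoid.Sum ℕ.+-0-monoid using () renaming (sum to ∑ℕ)
open import Data.Nat.Combinatorics using (_C_; nCk+nC[k+1]≡[n+1]C[k+1]; k>n⇒nCk≡0)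
open import Data.Nat.Coprimality using (Coprime; coprime-Bézout)
open import Data.Nat.Divisibility using (_∣_; ∣-trans; n∣m*n)
open import Data.Nat.DivMod using (_/_; m*[n/m]≡n)
open import Data.Nat.GCD using (module Bézout)
open import Data.Nat.Primality using (Prime; prime⇒irreducible; prime⇒nonTrivial; prime⇒nonZero)
open import Data.Product using (Σ; _,_; proj₁; proj₂)
open import Data.Sum using (_⊎_; inj₁; inj₂)
open import Data.Vec.Functional using (replicate)
open import Function using (_∘_)
open import Relation.Nullary using (¬_; Dec; yes; no)
open import Relation.Binary.PropositionalEquality as ≡ using (_≡_; _≢_)

module TaylorExpansion {c ℓ} (R : CommutativeRing c ℓ) where
  open CommutativeRing R hiding (zero)
  open import Algebra.Definitions _≈_ using (AlmostLeftCancellative)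
  open import Algebra.Properties.Semiring.Exp semiring using (_^_; ^-congʳ)
  open import Algebra.Properties.Semiring.Mult semiring using (_×_; ×-homo-+; ×-comm-*; ×-congʳ)
  open import Algebra.Solver.Ring.NaturalCoefficients.Default commutativeSemiring
  open import Relation.Binary.Reasoning.Setoid setoid
  open import Algebra.Properties.AbelianGroup +-abelianGroup using (xyx⁻¹≈y)
  open import Algebra.Properties.Group +-group using (x∙y⁻¹≈ε⇒x≈y)
  open import Algebra.Properties.CommutativeMonoid.Sum +-commutativeMonoid using () renaming (sum to ∑)

  Poly : Set c
  Poly = List Carrier

  coeff : Poly → ℕ → Carrier
  coeff []      i       = 0#
  coeff (a ∷ f) zero    = a
  coeff (a ∷ f) (suc i) = coeff f i

  -- taylor b j f is the coefficient of y ^ j in f (b + y), i.e. the j-th Hasse derivative of f at b.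
  taylor : Carrier → ℕ → Poly → Carrier
  taylor b j       []      = 0#
  taylor b zero    (a ∷ f) = a + b * taylor b zero f
  taylor b (suc j) (a ∷ f) = taylor b j f + b * taylor b (suc j) f

  taylor-congˡ : ∀ {b b′} j f → b ≈ b′ → taylor b j f ≈ taylor b′ j f
  taylor-congˡ j       []      b≈b′ = refl
  taylor-congˡ zero    (a ∷ f) b≈b′ = +-congˡ (*-cong b≈b′ (taylor-congˡ zero f b≈b′))
  taylor-congˡ (suc j) (a ∷ f) b≈b′ =
    +-cong (taylor-congˡ j f b≈b′) (*-cong b≈b′ (taylor-congˡ (suc j) f b≈b′))

  taylor-0#-coeff : ∀ j f → taylor 0# j f ≈ coeff f j
  taylor-0#-coeff j       []      = refl
  taylor-0#-coeff zero    (a ∷ f) = trans (+-congˡ (zeroˡ _)) (+-identityʳ a)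
  taylor-0#-coeff (suc j) (a ∷ f) = trans (+-cong (taylor-0#-coeff j f) (zeroˡ _)) (+-identityʳ _)

  -- The quotient of f by x - b, computed by synthetic division: f = (x - b) * quot b f + taylor b 0 f.
  quot : Carrier → Poly → Poly
  quot b []      = []
  quot b (a ∷ f) = taylor b 0 f ∷ quot b f

  taylor-quot : ∀ b j f → taylor b j (quot b f) ≈ taylor b (suc j) f
  taylor-quot b j       []      = refl
  taylor-quot b zero    (a ∷ f) = +-congˡ (*-congˡ (taylor-quot b 0 f))
  taylor-quot b (suc j) (a ∷ f) = +-cong (taylor-quot b j f) (*-congˡ (taylor-quot b (suc j) f))

  -- Expanding f = (x - b) * quot b f + f(b) around the point b + e.
  taylor-shift-quot₀ : ∀ b e f → taylor (b + e) 0 f ≈ e * taylor (b + e) 0 (quot b f) + taylor b 0 f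
  taylor-shift-quotₛ : ∀ b e j f →
    taylor (b + e) (suc j) f ≈ taylor (b + e) j (quot b f) + e * taylor (b + e) (suc j) (quot b f)

  taylor-shift-quot₀ b e [] = sym (trans (+-identityʳ _) (zeroʳ e))
  taylor-shift-quot₀ b e (a ∷ f) = begin
    a + (b + e) * taylor (b + e) 0 f     ≈⟨ +-congˡ (*-congˡ (taylor-shift-quot₀ b e f)) ⟩
    a + (b + e) * (e * q₀ + r)            ≈⟨ solve 5 (λ a b e q₀ r → a :+ (b :+ e) :* (e :* q₀ :+ r)
                                                                   := e :* (r :+ (b :+ e) :* q₀) :+ (a :+ b :* r))
                                               refl a b e q₀ r ⟩
    e * (r + (b + e) * q₀) + (a + b * r)  ∎
    where
    q₀ r : Carrier
    q₀ = taylor (b + e) 0 (quot b f)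
    r  = taylor b 0 f
  taylor-shift-quotₛ b e j [] = sym (trans (+-identityˡ _) (zeroʳ e))
  taylor-shift-quotₛ b e zero (a ∷ f) = begin
    taylor (b + e) 0 f + (b + e) * taylor (b + e) 1 f
      ≈⟨ +-cong (taylor-shift-quot₀ b e f) (*-congˡ (taylor-shift-quotₛ b e 0 f)) ⟩
    (e * q₀ + r) + (b + e) * (q₀ + e * q₁)
      ≈⟨ solve 5 (λ b e q₀ q₁ r → (e :* q₀ :+ r) :+ (b :+ e) :* (q₀ :+ e :* q₁)
                                 := (r :+ (b :+ e) :* q₀) :+ e :* (q₀ :+ (b :+ e) :* q₁)) refl b e q₀ q₁ r ⟩
    (r + (b + e) * q₀) + e * (q₀ + (b + e) * q₁)
      ∎
    where
    q₀ q₁ r : Carrier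
    q₀ = taylor (b + e) 0 (quot b f)
    q₁ = taylor (b + e) 1 (quot b f)
    r  = taylor b 0 f
  taylor-shift-quotₛ b e (suc j) (a ∷ f) = begin
    taylor (b + e) (suc j) f + (b + e) * taylor (b + e) (suc (suc j)) f
      ≈⟨ +-cong (taylor-shift-quotₛ b e j f) (*-congˡ (taylor-shift-quotₛ b e (suc j) f)) ⟩
    (qⱼ + e * qⱼ₊₁) + (b + e) * (qⱼ₊₁ + e * qⱼ₊₂)
      ≈⟨ solve 5 (λ b e x y z → (x :+ e :* y) :+ (b :+ e) :* (y :+ e :* z)
                               := (x :+ (b :+ e) :* y) :+ e :* (y :+ (b :+ e) :* z)) refl b e qⱼ qⱼ₊₁ qⱼ₊₂ ⟩
    (qⱼ + (b + e) * qⱼ₊₁) + e * (qⱼ₊₁ + (b + e) * qⱼ₊₂)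
      ∎
    where
    qⱼ qⱼ₊₁ qⱼ₊₂ : Carrier
    qⱼ   = taylor (b + e) j (quot b f)
    qⱼ₊₁ = taylor (b + e) (suc j) (quot b f)
    qⱼ₊₂ = taylor (b + e) (suc (suc j)) (quot b f)

  VanishesToOrder : ℕ → Carrier → Poly → Set ℓ
  VanishesToOrder k b f = ∀ j → j < k → taylor b j f ≈ 0#

  VanishesToOrder-quot-self : ∀ {k b} f → VanishesToOrder (suc k) b f → VanishesToOrder k b (quot b f)
  VanishesToOrder-quot-self {b = b} f v j j<k = trans (taylor-quot b j f) (v (suc j) (s≤s j<k))

  record HasDegree (D : ℕ) (f : Poly) : Set ℓ where
    field
      leading-nonzero : ¬ coeff f D ≈ 0#
      coeff-beyond    : ∀ i → D < i → coeff f i ≈ 0#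

  coeff-drop : ∀ k f i → coeff (drop k f) i ≡ coeff f (k ℕ.+ i)
  coeff-drop zero    f       i = ≡.refl
  coeff-drop (suc k) []      i = ≡.refl
  coeff-drop (suc k) (a ∷ f) i = coeff-drop k f i

  coeff-quot : ∀ b f i → coeff (quot b f) i ≈ taylor b 0 (drop (suc i) f)
  coeff-quot b []      i       = refl
  coeff-quot b (a ∷ f) zero    = refl
  coeff-quot b (a ∷ f) (suc i) = coeff-quot b f i

  taylor-of-zero-coeffs : ∀ b f → (∀ i → coeff f i ≈ 0#) → taylor b 0 f ≈ 0#
  taylor-of-zero-coeffs b []      z = refl
  taylor-of-zero-coeffs b (a ∷ f) z =
    trans (+-cong (z 0) (trans (*-congˡ (taylor-of-zero-coeffs b f (z ∘ suc))) (zeroʳ b))) (+-identityʳ 0#)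

  taylor-of-constant : ∀ b f → (∀ i → coeff f (suc i) ≈ 0#) → taylor b 0 f ≈ coeff f 0
  taylor-of-constant b []      z = refl
  taylor-of-constant b (a ∷ f) z =
    trans (+-congˡ (trans (*-congˡ (taylor-of-zero-coeffs b f z)) (zeroʳ b))) (+-identityʳ a)

  HasDegree-quot : ∀ {D} b f → HasDegree (suc D) f → HasDegree D (quot b f)
  HasDegree-quot {D} b f deg = record { leading-nonzero = leading ; coeff-beyond = beyond }
    where
    open HasDegree deg
    tail-coeff : ∀ i j → coeff (drop (suc i) f) j ≈ coeff f (suc i ℕ.+ j)
    tail-coeff i j = reflexive (coeff-drop (suc i) f j)
    leading : ¬ coeff (quot b f) D ≈ 0#
    leading z = leading-nonzero (begin
      coeff f (suc D)              ≡⟨ ≡.cong (coeff f) (ℕ.+-identityʳ (suc D)) ⟨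
      coeff f (suc D ℕ.+ 0)        ≈⟨ tail-coeff D 0 ⟨
      coeff (drop (suc D) f) 0     ≈⟨ taylor-of-constant b (drop (suc D) f) tail-beyond ⟨
      taylor b 0 (drop (suc D) f)  ≈⟨ coeff-quot b f D ⟨
      coeff (quot b f) D           ≈⟨ z ⟩
      0#                           ∎)
      where
      tail-beyond : ∀ i → coeff (drop (suc D) f) (suc i) ≈ 0#
      tail-beyond i = trans (tail-coeff D (suc i)) (coeff-beyond _ (s≤s (ℕ.m<m+n D (s≤s z≤n))))
    beyond : ∀ i → D < i → coeff (quot b f) i ≈ 0#
    beyond i D<i = trans (coeff-quot b f i) (taylor-of-zero-coeffs b (drop (suc i) f)
      (λ j → trans (tail-coeff i j) (coeff-beyond _ (s≤s (ℕ.≤-trans D<i (ℕ.m≤m+n i j))))))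

  HasDegree-zero⇒nonvanishing : ∀ b f → HasDegree 0 f → ¬ taylor b 0 f ≈ 0#
  HasDegree-zero⇒nonvanishing b f deg z =
    leading-nonzero (trans (sym (taylor-of-constant b f (λ i → coeff-beyond (suc i) (s≤s z≤n)))) z)
    where open HasDegree deg

  VanishesToOrder-congˡ : ∀ {k b b′} f → b ≈ b′ → VanishesToOrder k b f → VanishesToOrder k b′ f
  VanishesToOrder-congˡ f b≈b′ v j j<k = trans (taylor-congˡ j f (sym b≈b′)) (v j j<k)

  module _ (*-cancelˡ-nonZero : AlmostLeftCancellative 0# _*_) where

    private
      factor-vanishes : ∀ {a x} → ¬ a ≈ 0# → a * x ≈ 0# → x ≈ 0#
      factor-vanishes {a} {x} a≉0 ax≈0 = *-cancelˡ-nonZero a x 0# a≉0 (trans ax≈0 (sym (zeroʳ a)))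

    VanishesToOrder-quot-shift : ∀ {k b e} f → ¬ e ≈ 0# → taylor b 0 f ≈ 0# →
      VanishesToOrder k (b + e) f → VanishesToOrder k (b + e) (quot b f)
    VanishesToOrder-quot-shift {k} {b} {e} f e≉0 fb≈0 v = go
      where
      go : VanishesToOrder k (b + e) (quot b f)
      go zero 0<k = factor-vanishes e≉0 (begin
        e * taylor (b + e) 0 (quot b f)                  ≈⟨ +-identityʳ _ ⟨
        e * taylor (b + e) 0 (quot b f) + 0#             ≈⟨ +-congˡ fb≈0 ⟨
        e * taylor (b + e) 0 (quot b f) + taylor b 0 f   ≈⟨ taylor-shift-quot₀ b e f ⟨
        taylor (b + e) 0 f                                ≈⟨ v 0 0<k ⟩
        0#                                                ∎)
      go (suc j) j<k = factor-vanishes e≉0 (begin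
        e * qⱼ₊₁                                    ≈⟨ +-identityˡ _ ⟨
        0# + e * qⱼ₊₁                               ≈⟨ +-congʳ (go j (ℕ.<-trans (ℕ.n<1+n j) j<k)) ⟨
        taylor (b + e) j (quot b f) + e * qⱼ₊₁      ≈⟨ taylor-shift-quotₛ b e j f ⟨
        taylor (b + e) (suc j) f                    ≈⟨ v (suc j) j<k ⟩
        0#                                          ∎)
        where
        qⱼ₊₁ : Carrier
        qⱼ₊₁ = taylor (b + e) (suc j) (quot b f)

    VanishesToOrder-quot : ∀ {k b b′} f → ¬ b′ ≈ b → taylor b 0 f ≈ 0# →
      VanishesToOrder k b′ f → VanishesToOrder k b′ (quot b f)
    VanishesToOrder-quot {b = b} {b′} f b′≉b fb≈0 v =
      VanishesToOrder-congˡ (quot b f) b+e≈b′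
        (VanishesToOrder-quot-shift f (b′≉b ∘ x∙y⁻¹≈ε⇒x≈y b′ b) fb≈0
          (VanishesToOrder-congˡ f (sym b+e≈b′) v))
      where
      b+e≈b′ : b + (b′ - b) ≈ b′
      b+e≈b′ = trans (sym (+-assoc b b′ (- b))) (xyx⁻¹≈y b b′)

    -- Dividing out a root b₀ lowers its order by one and keeps the orders at the other points.
    ∑-orders≤degree : ∀ {D} K (b : Fin K → Carrier) (k : Fin K → ℕ) f →
      (∀ i j → i ≢ j → ¬ b i ≈ b j) → HasDegree D f → (∀ i → VanishesToOrder (k i) (b i) f) →
      ∑ℕ k ≤ D
    ∑-orders≤degree zero    b k f distinct deg vanish = z≤n
    ∑-orders≤degree (suc K) b k f distinct deg vanish = peel (k zero) f deg (vanish zero) (vanish ∘ suc)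
      where
      peel : ∀ k₀ {D} g → HasDegree D g → VanishesToOrder k₀ (b zero) g →
        (∀ i → VanishesToOrder (k (suc i)) (b (suc i)) g) → k₀ ℕ.+ ∑ℕ (k ∘ suc) ≤ D
      peel zero g deg _ vs = ∑-orders≤degree K (b ∘ suc) (k ∘ suc) g
        (λ i j i≢j → distinct (suc i) (suc j) (i≢j ∘ suc-injective)) deg vs
      peel (suc k₀) {zero} g deg v₀ _ =
        ⊥-elim (HasDegree-zero⇒nonvanishing (b zero) g deg (v₀ 0 (s≤s z≤n)))
      peel (suc k₀) {suc D} g deg v₀ vs = s≤s (peel k₀ (quot (b zero) g) (HasDegree-quot (b zero) g deg)
        (VanishesToOrder-quot-self g v₀)
        (λ i → VanishesToOrder-quot g (distinct (suc i) zero λ ()) (v₀ 0 (s≤s z≤n)) (vs i)))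

  ^-zero : ∀ {u e} → u ≈ 0# → 0 < e → u ^ e ≈ 0#
  ^-zero u≈0 (s≤s z≤n) = trans (*-congʳ u≈0) (zeroˡ _)

  infixl 6 _+ₚ_
  infixr 7 _·ₚ_ [x+_]*_
  infixr 8 [x+_]^_

  _+ₚ_ : Poly → Poly → Poly
  []      +ₚ g       = g
  (a ∷ f) +ₚ []      = a ∷ f
  (a ∷ f) +ₚ (c ∷ g) = (a + c) ∷ (f +ₚ g)

  ∑ₚ : ∀ {n} → (Fin n → Poly) → Poly
  ∑ₚ {zero}  f = []
  ∑ₚ {suc n} f = f zero +ₚ ∑ₚ (f ∘ suc)

  _·ₚ_ : Carrier → Poly → Poly
  c ·ₚ f = map (c *_) f

  [x+_]*_ : Carrier → Poly → Poly
  [x+ e ]* f = (0# ∷ f) +ₚ e ·ₚ f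

  [x+_]^_ : Carrier → ℕ → Poly
  [x+ a ]^ zero  = 1# ∷ []
  [x+ a ]^ suc M = [x+ a ]* [x+ a ]^ M

  taylor-+ₚ : ∀ b j f g → taylor b j (f +ₚ g) ≈ taylor b j f + taylor b j g
  taylor-+ₚ b j       []      g       = sym (+-identityˡ _)
  taylor-+ₚ b j       (a ∷ f) []      = sym (+-identityʳ _)
  taylor-+ₚ b zero    (a ∷ f) (c ∷ g) = begin
    (a + c) + b * taylor b 0 (f +ₚ g)  ≈⟨ +-congˡ (*-congˡ (taylor-+ₚ b 0 f g)) ⟩
    (a + c) + b * (f₀ + g₀)            ≈⟨ solve 5 (λ a c b x y → (a :+ c) :+ b :* (x :+ y)
                                                              := (a :+ b :* x) :+ (c :+ b :* y)) refl a c b f₀ g₀ ⟩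
    (a + b * f₀) + (c + b * g₀)        ∎
    where
    f₀ g₀ : Carrier
    f₀ = taylor b 0 f
    g₀ = taylor b 0 g
  taylor-+ₚ b (suc j) (a ∷ f) (c ∷ g) = begin
    taylor b j (f +ₚ g) + b * taylor b (suc j) (f +ₚ g)
      ≈⟨ +-cong (taylor-+ₚ b j f g) (*-congˡ (taylor-+ₚ b (suc j) f g)) ⟩
    (fⱼ + gⱼ) + b * (fⱼ₊₁ + gⱼ₊₁)
      ≈⟨ solve 5 (λ x y b z w → (x :+ y) :+ b :* (z :+ w) := (x :+ b :* z) :+ (y :+ b :* w))
                 refl fⱼ gⱼ b fⱼ₊₁ gⱼ₊₁ ⟩
    (fⱼ + b * fⱼ₊₁) + (gⱼ + b * gⱼ₊₁)
      ∎
    where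
    fⱼ gⱼ fⱼ₊₁ gⱼ₊₁ : Carrier
    fⱼ   = taylor b j f
    gⱼ   = taylor b j g
    fⱼ₊₁ = taylor b (suc j) f
    gⱼ₊₁ = taylor b (suc j) g

  taylor-∑ₚ : ∀ b j {n} (f : Fin n → Poly) → taylor b j (∑ₚ f) ≈ ∑ (λ i → taylor b j (f i))
  taylor-∑ₚ b j {zero}  f = refl
  taylor-∑ₚ b j {suc n} f =
    trans (taylor-+ₚ b j (f zero) (∑ₚ (f ∘ suc))) (+-congˡ (taylor-∑ₚ b j (f ∘ suc)))

  taylor-·ₚ : ∀ b j c f → taylor b j (c ·ₚ f) ≈ c * taylor b j f
  taylor-·ₚ b j       c []      = sym (zeroʳ c)
  taylor-·ₚ b zero    c (a ∷ f) = trans (+-congˡ (*-congˡ (taylor-·ₚ b 0 c f)))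
    (solve 4 (λ c a b x → c :* a :+ b :* (c :* x) := c :* (a :+ b :* x)) refl c a b (taylor b 0 f))
  taylor-·ₚ b (suc j) c (a ∷ f) = trans (+-cong (taylor-·ₚ b j c f) (*-congˡ (taylor-·ₚ b (suc j) c f)))
    (solve 4 (λ c x b y → c :* x :+ b :* (c :* y) := c :* (x :+ b :* y))
       refl c (taylor b j f) b (taylor b (suc j) f))

  taylor-[x+]*₀ : ∀ b e f → taylor b 0 ([x+ e ]* f) ≈ (b + e) * taylor b 0 f
  taylor-[x+]*₀ b e f = begin
    taylor b 0 ([x+ e ]* f)                        ≈⟨ taylor-+ₚ b 0 (0# ∷ f) (e ·ₚ f) ⟩
    (0# + b * taylor b 0 f) + taylor b 0 (e ·ₚ f)  ≈⟨ +-cong (+-identityˡ _) (taylor-·ₚ b 0 e f) ⟩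
    b * taylor b 0 f + e * taylor b 0 f            ≈⟨ distribʳ _ b e ⟨
    (b + e) * taylor b 0 f                         ∎

  taylor-[x+]*ₛ : ∀ b e j f → taylor b (suc j) ([x+ e ]* f) ≈ taylor b j f + (b + e) * taylor b (suc j) f
  taylor-[x+]*ₛ b e j f = begin
    taylor b (suc j) ([x+ e ]* f)           ≈⟨ taylor-+ₚ b (suc j) (0# ∷ f) (e ·ₚ f) ⟩
    (fⱼ + b * fⱼ₊₁) + taylor b (suc j) (e ·ₚ f)  ≈⟨ +-congˡ (taylor-·ₚ b (suc j) e f) ⟩
    (fⱼ + b * fⱼ₊₁) + e * fⱼ₊₁              ≈⟨ +-assoc _ _ _ ⟩
    fⱼ + (b * fⱼ₊₁ + e * fⱼ₊₁)              ≈⟨ +-congˡ (distribʳ _ b e) ⟨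
    fⱼ + (b + e) * fⱼ₊₁                     ∎
    where
    fⱼ fⱼ₊₁ : Carrier
    fⱼ   = taylor b j f
    fⱼ₊₁ = taylor b (suc j) f

  taylor-[x+]^ : ∀ b a M j → taylor b j ([x+ a ]^ M) ≈ (M C j) × (b + a) ^ (M ∸ j)
  taylor-[x+]^ b a zero    zero    = +-congˡ (zeroʳ b)
  taylor-[x+]^ b a zero    (suc j) = trans (+-identityˡ _) (zeroʳ b)
  taylor-[x+]^ b a (suc M) zero    = begin
    taylor b 0 ([x+ a ]* [x+ a ]^ M)   ≈⟨ taylor-[x+]*₀ b a ([x+ a ]^ M) ⟩
    (b + a) * taylor b 0 ([x+ a ]^ M)  ≈⟨ *-congˡ (taylor-[x+]^ b a M 0) ⟩
    (b + a) * (1 × (b + a) ^ M)        ≈⟨ ×-comm-* 1 (b + a) _ ⟩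
    1 × (b + a) ^ suc M                ∎
  taylor-[x+]^ b a (suc M) (suc j) = begin
    taylor b (suc j) ([x+ a ]* [x+ a ]^ M)
      ≈⟨ taylor-[x+]*ₛ b a j ([x+ a ]^ M) ⟩
    taylor b j ([x+ a ]^ M) + u * taylor b (suc j) ([x+ a ]^ M)
      ≈⟨ +-cong (taylor-[x+]^ b a M j) (*-congˡ (taylor-[x+]^ b a M (suc j))) ⟩
    (M C j) × u ^ (M ∸ j) + u * ((M C suc j) × u ^ (M ∸ suc j))
      ≈⟨ +-congˡ raise ⟩
    (M C j) × u ^ (M ∸ j) + (M C suc j) × u ^ (M ∸ j)
      ≈⟨ ×-homo-+ _ (M C j) (M C suc j) ⟨
    (M C j ℕ.+ M C suc j) × u ^ (M ∸ j)
      ≡⟨ ≡.cong (_× u ^ (M ∸ j)) (nCk+nC[k+1]≡[n+1]C[k+1] M j) ⟩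
    (suc M C suc j) × u ^ (M ∸ j)
      ∎
    where
    u : Carrier
    u = b + a
    raise : u * ((M C suc j) × u ^ (M ∸ suc j)) ≈ (M C suc j) × u ^ (M ∸ j)
    raise with j ℕ.<? M
    ... | yes j<M = trans (×-comm-* (M C suc j) u _)
                          (×-congʳ (M C suc j) (^-congʳ u (≡.sym (ℕ.+-∸-assoc 1 j<M))))
    ... | no  j≮M rewrite k>n⇒nCk≡0 (s≤s (ℕ.≮⇒≥ j≮M)) = zeroʳ u

∸-beyond : ∀ {L m i} → 0 < L → m < i → (L ℕ.+ m) ∸ i < L
∸-beyond {L} {m} {i} 0<L m<i with i ℕ.≤? L ℕ.+ m
... | yes i≤L+m = ℕ.≤-trans (ℕ.∸-monoʳ-< m<i i≤L+m) (ℕ.≤-reflexive (ℕ.m+n∸n≡m L m))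
... | no  i≰L+m = ≡.subst (_< L) (≡.sym (ℕ.m≤n⇒m∸n≡0 (ℕ.<⇒≤ (ℕ.≰⇒> i≰L+m)))) 0<L

module StepanovPolynomial {c ℓ} (R : CommutativeRing c ℓ) where
  open CommutativeRing R hiding (zero)
  open TaylorExpansion R
  open import Algebra.Properties.Semiring.Exp semiring using (_^_; ^-homo-*)
  open import Algebra.Properties.Semiring.Mult semiring using (_×_; ×-comm-*; ×-assoc-*; ×-congʳ)
  open import Algebra.Properties.Semiring.Sum semiring using (*-distribˡ-sum)
  open import Algebra.Properties.CommutativeMonoid.Sum +-commutativeMonoid
    using () renaming (sum to ∑; sum-cong-≋ to ∑-cong)
  open import Relation.Binary.Reasoning.Setoid setoid

  moment : ∀ {L} → (a w : Fin (suc L) → Carrier) → Carrier → ℕ → Carrier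
  moment a w b k = ∑ (λ i → w i * (b + a i) ^ k)

  moment-congʳ : ∀ {L} (a w : Fin (suc L) → Carrier) b {k k′} →
    (∀ i → (b + a i) ^ k ≈ (b + a i) ^ k′) → moment a w b k ≈ moment a w b k′
  moment-congʳ {L} a w b eq = ∑-cong {suc L} (λ i → *-congˡ {w i} (eq i))

  -- The weights w of the divided difference at the nodes a₀, …, a_L: ∑ᵢ wᵢ φ(aᵢ) is the leading
  -- coefficient of the interpolation polynomial of φ, so it kills the powers below L.
  record IsDividedDifference (L : ℕ) (a w : Fin (suc L) → Carrier) : Set (c ⊔ ℓ) where
    field
      moment-below : ∀ b k → k < L → moment a w b k ≈ 0#
      moment-top   : ∀ b → moment a w b L ≈ 1#

  module _ {L} {a w : Fin (suc L) → Carrier} (dd : IsDividedDifference L a w) (m : ℕ) where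
    open IsDividedDifference dd

    private
      M : ℕ
      M = L ℕ.+ m

      weightedPowers : Poly
      weightedPowers = ∑ₚ (λ i → w i ·ₚ [x+ a i ]^ M)

      taylor-weightedPowers : ∀ b j → taylor b j weightedPowers ≈ (M C j) × 1# * moment a w b (M ∸ j)
      taylor-weightedPowers b j = begin
        taylor b j weightedPowers                             ≈⟨ taylor-∑ₚ b j (λ i → w i ·ₚ [x+ a i ]^ M) ⟩
        ∑ (λ i → taylor b j (w i ·ₚ [x+ a i ]^ M))            ≈⟨ ∑-cong {suc L} (λ i → expand (w i) (a i)) ⟩
        ∑ (λ i → (M C j) × 1# * (w i * (b + a i) ^ (M ∸ j)))
          ≈⟨ *-distribˡ-sum ((M C j) × 1#) (λ i → w i * (b + a i) ^ (M ∸ j)) ⟨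
        (M C j) × 1# * moment a w b (M ∸ j)                   ∎
        where
        expand : ∀ c a → taylor b j (c ·ₚ [x+ a ]^ M) ≈ (M C j) × 1# * (c * (b + a) ^ (M ∸ j))
        expand c a = begin
          taylor b j (c ·ₚ [x+ a ]^ M)               ≈⟨ taylor-·ₚ b j c ([x+ a ]^ M) ⟩
          c * taylor b j ([x+ a ]^ M)                ≈⟨ *-congˡ (taylor-[x+]^ b a M j) ⟩
          c * ((M C j) × (b + a) ^ (M ∸ j))          ≈⟨ ×-comm-* (M C j) c _ ⟩
          (M C j) × (c * (b + a) ^ (M ∸ j))          ≈⟨ ×-congʳ (M C j) (*-identityˡ _) ⟨
          (M C j) × (1# * (c * (b + a) ^ (M ∸ j)))   ≈⟨ ×-assoc-* (M C j) 1# _ ⟨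
          (M C j) × 1# * (c * (b + a) ^ (M ∸ j))     ∎

    stepanovPoly : Poly
    stepanovPoly = weightedPowers +ₚ (- 1# ∷ [])

    taylor-stepanovPoly-zero : ∀ b → taylor b 0 stepanovPoly ≈ moment a w b M - 1#
    taylor-stepanovPoly-zero b = begin
      taylor b 0 stepanovPoly                        ≈⟨ taylor-+ₚ b 0 weightedPowers (- 1# ∷ []) ⟩
      taylor b 0 weightedPowers + (- 1# + b * 0#)    ≈⟨ +-cong (taylor-weightedPowers b 0) (+-congˡ (zeroʳ b)) ⟩
      (1# + 0#) * moment a w b M + (- 1# + 0#)
        ≈⟨ +-cong (trans (*-congʳ (+-identityʳ 1#)) (*-identityˡ _)) (+-identityʳ _) ⟩
      moment a w b M - 1#                            ∎

    taylor-stepanovPoly-suc : ∀ b j →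
      taylor b (suc j) stepanovPoly ≈ (M C suc j) × 1# * moment a w b (M ∸ suc j)
    taylor-stepanovPoly-suc b j = begin
      taylor b (suc j) stepanovPoly                                ≈⟨ taylor-+ₚ b (suc j) weightedPowers (- 1# ∷ []) ⟩
      taylor b (suc j) weightedPowers + (0# + b * 0#)              ≈⟨ +-cong (taylor-weightedPowers b (suc j)) (+-identityˡ _) ⟩
      (M C suc j) × 1# * moment a w b (M ∸ suc j) + b * 0#         ≈⟨ trans (+-congˡ (zeroʳ b)) (+-identityʳ _) ⟩
      (M C suc j) × 1# * moment a w b (M ∸ suc j)                  ∎

    stepanovPoly-degree : 0 < L → 0 < m → ¬ (M C m) × 1# ≈ 0# → HasDegree m stepanovPoly
    stepanovPoly-degree 0<L (s≤s {n = m′} z≤n) binom≉0 = record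
      { leading-nonzero = leading
      ; coeff-beyond    = beyond
      }
      where
      leading : ¬ coeff stepanovPoly m ≈ 0#
      leading coeff≈0 = binom≉0 (begin
        (M C m) × 1#                           ≈⟨ *-identityʳ _ ⟨
        (M C m) × 1# * 1#                      ≈⟨ *-congˡ (moment-top 0#) ⟨
        (M C m) × 1# * moment a w 0# L         ≡⟨ ≡.cong (λ e → (M C m) × 1# * moment a w 0# e) (ℕ.m+n∸n≡m L m) ⟨
        (M C m) × 1# * moment a w 0# (M ∸ m)   ≈⟨ taylor-stepanovPoly-suc 0# m′ ⟨
        taylor 0# m stepanovPoly               ≈⟨ taylor-0#-coeff m stepanovPoly ⟩
        coeff stepanovPoly m                   ≈⟨ coeff≈0 ⟩
        0#                                     ∎)
      beyond : ∀ i → m < i → coeff stepanovPoly i ≈ 0#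
      beyond (suc i) m<i = begin
        coeff stepanovPoly (suc i)                       ≈⟨ taylor-0#-coeff (suc i) stepanovPoly ⟨
        taylor 0# (suc i) stepanovPoly                   ≈⟨ taylor-stepanovPoly-suc 0# i ⟩
        (M C suc i) × 1# * moment a w 0# (M ∸ suc i)     ≈⟨ *-congˡ (moment-below 0# (M ∸ suc i) (∸-beyond 0<L m<i)) ⟩
        (M C suc i) × 1# * 0#                            ≈⟨ zeroʳ _ ⟩
        0#                                               ∎

    stepanovPoly-vanishes : ∀ {b k} → k ≤ suc L →
      (∀ j → j < k → ∀ i → (b + a i) ^ (M ∸ j) ≈ (b + a i) ^ (L ∸ j)) → VanishesToOrder k b stepanovPoly
    stepanovPoly-vanishes {b} k≤1+L reduce zero 0<k = begin
      taylor b 0 stepanovPoly   ≈⟨ taylor-stepanovPoly-zero b ⟩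
      moment a w b M - 1#       ≈⟨ +-congʳ (moment-congʳ a w b {M} {L} (reduce 0 0<k)) ⟩
      moment a w b L - 1#       ≈⟨ +-congʳ (moment-top b) ⟩
      1# - 1#                   ≈⟨ -‿inverseʳ 1# ⟩
      0#                        ∎
    stepanovPoly-vanishes {b} k≤1+L reduce (suc j) j<k = begin
      taylor b (suc j) stepanovPoly                   ≈⟨ taylor-stepanovPoly-suc b j ⟩
      (M C suc j) × 1# * moment a w b (M ∸ suc j)     ≈⟨ *-congˡ (moment-congʳ a w b {M ∸ suc j} {L ∸ suc j} (reduce (suc j) j<k)) ⟩
      (M C suc j) × 1# * moment a w b (L ∸ suc j)     ≈⟨ *-congˡ (moment-below b (L ∸ suc j) L∸j<L) ⟩
      (M C suc j) × 1# * 0#                           ≈⟨ zeroʳ _ ⟩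
      0#                                              ∎
      where
      L∸j<L : L ∸ suc j < L
      L∸j<L = ℕ.∸-monoʳ-< (s≤s z≤n) (ℕ.≤-pred (ℕ.≤-trans j<k k≤1+L))

    ^-reduce : ∀ {u j} → u ^ m ≈ 1# → j ≤ L → u ^ (M ∸ j) ≈ u ^ (L ∸ j)
    ^-reduce {u} {j} uᵐ≈1 j≤L = begin
      u ^ (M ∸ j)              ≡⟨ ≡.cong (u ^_) (ℕ.+-∸-comm m j≤L) ⟩
      u ^ ((L ∸ j) ℕ.+ m)      ≈⟨ ^-homo-* u (L ∸ j) m ⟩
      u ^ (L ∸ j) * u ^ m      ≈⟨ *-congˡ uᵐ≈1 ⟩
      u ^ (L ∸ j) * 1#         ≈⟨ *-identityʳ _ ⟩
      u ^ (L ∸ j)              ∎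

    stepanovPoly-vanishes-off-nodes : ∀ {b} → (∀ i → (b + a i) ^ m ≈ 1#) →
      VanishesToOrder (suc L) b stepanovPoly
    stepanovPoly-vanishes-off-nodes uᵐ≈1 =
      stepanovPoly-vanishes ℕ.≤-refl (λ j j<1+L i → ^-reduce (uᵐ≈1 i) (ℕ.≤-pred j<1+L))

    stepanovPoly-vanishes-at-node : ∀ {b} → (∀ i → (b + a i) ^ m ≈ 1# ⊎ b + a i ≈ 0#) →
      VanishesToOrder L b stepanovPoly
    stepanovPoly-vanishes-at-node {b} node = stepanovPoly-vanishes (ℕ.n≤1+n L) reduce
      where
      reduce : ∀ j → j < L → ∀ i → (b + a i) ^ (M ∸ j) ≈ (b + a i) ^ (L ∸ j)
      reduce j j<L i with node i
      ... | inj₁ uᵐ≈1 = ^-reduce uᵐ≈1 (ℕ.<⇒≤ j<L)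
      ... | inj₂ u≈0  = trans (^-zero u≈0 0<M∸j) (sym (^-zero u≈0 0<L∸j))
        where
        0<L∸j : 0 < L ∸ j
        0<L∸j = ℕ.m<n⇒0<n∸m j<L
        0<M∸j : 0 < M ∸ j
        0<M∸j = ℕ.≤-trans 0<L∸j (ℕ.∸-monoˡ-≤ j (ℕ.m≤m+n L m))

prime∤⇒coprime : ∀ {p K} → Prime p → ¬ p ∣ K → Coprime p K
prime∤⇒coprime {p} {K} p-prime p∤K {d} (d∣p , d∣K) with prime⇒irreducible p-prime d∣p
... | inj₁ d≡1 = d≡1
... | inj₂ d≡p = ⊥-elim (p∤K (≡.subst (_∣ K) d≡p d∣K))

module FiniteFieldFacts {q} (F : FiniteField q) where
  open FiniteField F hiding (zero)
  open StepanovPolynomial commRing using (IsDividedDifference; moment)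
  open import Algebra.Definitions _≈_ using (AlmostLeftCancellative)
  open import Algebra.Properties.Semiring.Exp semiring using (_^_)
  open import Algebra.Properties.Semiring.Mult semiring using (_×_; ×1-homo-*)
  open import Relation.Binary.Reasoning.Setoid setoid
  import Algebra.Properties.CommutativeMonoid.Sum as MonoidSum
  open import Algebra.Properties.Group +-group using (identityʳ-unique; x∙y⁻¹≈ε⇒x≈y)
  open import Algebra.Properties.AbelianGroup +-abelianGroup using (xyx⁻¹≈y)
  open import Algebra.Properties.Semiring.Sum semiring using (*-distribˡ-sum)
  open import Algebra.Solver.Ring.NaturalCoefficients.Default commutativeSemiring
  open MonoidSum +-commutativeMonoid
    using (∑-distrib-+; sum-replicate) renaming (sum to ∑; sum-cong-≋ to sum-cong)
  open MonoidSum *-commutativeMonoid using () renaming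
    ( sum to ∏; ∑-distrib-+ to ∏-distrib-*; sum-replicate to ∏-replicate
    ; sum-remove to ∏-remove; sum-cong-≋ to ∏-cong )

  index : Carrier → Fin q
  index x = proj₁ (enum-surjective x)

  enum-index : ∀ x → enum (index x) ≈ x
  enum-index x = proj₂ (enum-surjective x)

  infix 4 _≟_
  _≟_ : (x y : Carrier) → Dec (x ≈ y)
  x ≟ y with index x Fin.≟ index y
  ... | yes i≡j = yes (trans (sym (enum-index x)) (trans (reflexive (≡.cong enum i≡j)) (enum-index y)))
  ... | no  i≢j = no λ x≈y → i≢j (enum-injective _ _ (trans (enum-index x) (trans x≈y (sym (enum-index y)))))

  -- 0# ⁻¹ is a junk value (0#).
  infix 8 _⁻¹
  _⁻¹ : Carrier → Carrier
  x ⁻¹ with x ≟ 0#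
  ... | yes _   = 0#
  ... | no  x≉0 = proj₁ (inverse x x≉0)

  x*x⁻¹≈1 : ∀ {x} → ¬ x ≈ 0# → x * x ⁻¹ ≈ 1#
  x*x⁻¹≈1 {x} x≉0 with x ≟ 0#
  ... | yes x≈0  = ⊥-elim (x≉0 x≈0)
  ... | no  x≉0′ = proj₂ (inverse x x≉0′)

  *-cancelˡ-nonZero : AlmostLeftCancellative 0# _*_
  *-cancelˡ-nonZero a x y a≉0 ax≈ay = begin
    x                ≈⟨ *-identityˡ x ⟨
    1# * x           ≈⟨ *-congʳ (trans (*-comm _ _) (x*x⁻¹≈1 a≉0)) ⟨
    (a ⁻¹ * a) * x   ≈⟨ *-assoc _ _ _ ⟩
    a ⁻¹ * (a * x)   ≈⟨ *-congˡ ax≈ay ⟩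
    a ⁻¹ * (a * y)   ≈⟨ *-assoc _ _ _ ⟨
    (a ⁻¹ * a) * y   ≈⟨ *-congʳ (trans (*-comm _ _) (x*x⁻¹≈1 a≉0)) ⟩
    1# * y           ≈⟨ *-identityˡ y ⟩
    y                ∎

  *-nonZero : ∀ {x y} → ¬ x ≈ 0# → ¬ y ≈ 0# → ¬ x * y ≈ 0#
  *-nonZero {x} {y} x≉0 y≉0 xy≈0 = y≉0 (*-cancelˡ-nonZero x y 0# x≉0 (trans xy≈0 (sym (zeroʳ x))))

  ^-nonZero : ∀ {x} n → ¬ x ≈ 0# → ¬ x ^ n ≈ 0#
  ^-nonZero zero    x≉0 = 1≉0
  ^-nonZero (suc n) x≉0 = *-nonZero x≉0 (^-nonZero n x≉0)

  module _ (M : CommutativeMonoid 0ℓ 0ℓ) where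
    open CommutativeMonoid M using () renaming (Carrier to A; _≈_ to _≈ᴬ_)
    open MonoidSum M using (sum; sum-permute; sum-cong-≋)

    sum-reindex : (f : Carrier → A) → (∀ {x y} → x ≈ y → f x ≈ᴬ f y) →
      (σ τ : Carrier → Carrier) → (∀ {x y} → x ≈ y → σ x ≈ σ y) → (∀ {x y} → x ≈ y → τ x ≈ τ y) →
      (∀ x → σ (τ x) ≈ x) → (∀ x → τ (σ x) ≈ x) →
      sum (f ∘ enum) ≈ᴬ sum (f ∘ σ ∘ enum)
    sum-reindex f f-cong σ τ σ-cong τ-cong στ τσ =
      CommutativeMonoid.trans M (sum-permute (f ∘ enum) π)
        (sum-cong-≋ {q} (λ i → f-cong (enum-index (σ (enum i)))))
      where
      π : Permutation q q
      π = permutation (index ∘ σ ∘ enum) (index ∘ τ ∘ enum)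
        (λ i → enum-injective _ _ (trans (enum-index _) (trans (σ-cong (enum-index _)) (στ _))))
        (λ i → enum-injective _ _ (trans (enum-index _) (trans (τ-cong (enum-index _)) (τσ _))))

  q×1≈0 : q × 1# ≈ 0#
  q×1≈0 = identityʳ-unique S (q × 1#) (begin
    S + q × 1#                    ≈⟨ +-congˡ (sum-replicate q) ⟨
    S + ∑ (replicate q 1#)        ≈⟨ ∑-distrib-+ enum (replicate q 1#) ⟨
    ∑ (λ i → enum i + 1#)         ≈⟨ sum-reindex +-commutativeMonoid (λ x → x) (λ x≈y → x≈y) (_+ 1#) (_+ - 1#)
                                       +-congʳ +-congʳ (cancel (-‿inverseʳ 1#)) (cancel (-‿inverseˡ 1#)) ⟨
    S                             ∎)
    where
    S : Carrier
    S = ∑ enum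
    cancel : ∀ {a b} → a + b ≈ 0# → ∀ x → (x + b) + a ≈ x
    cancel {a} {b} a+b≈0 x = trans (+-assoc x b a) (trans (+-congˡ (trans (+-comm b a) a+b≈0)) (+-identityʳ x))

  ∏-nonZero : ∀ n (t : Fin n → Carrier) → (∀ i → ¬ t i ≈ 0#) → ¬ ∏ t ≈ 0#
  ∏-nonZero zero    t t≉0 = 1≉0
  ∏-nonZero (suc n) t t≉0 = *-nonZero (t≉0 zero) (∏-nonZero n (t ∘ suc) (t≉0 ∘ suc))

  ∏-constant-but-one : ∀ n (t : Fin n → Carrier) i z → t i ≈ 1# → (∀ j → j ≢ i → t j ≈ z) →
    ∏ t ≈ z ^ (n ∸ 1)
  ∏-constant-but-one (suc n) t i z tᵢ≈1 t≈z = begin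
    ∏ t                                  ≈⟨ ∏-remove {i = i} t ⟩
    t i * ∏ (λ j → t (Fin.punchIn i j))  ≈⟨ *-cong tᵢ≈1 (∏-cong {n} (λ j → t≈z _ (punchInᵢ≢i i j))) ⟩
    1# * ∏ (replicate n z)               ≈⟨ *-identityˡ _ ⟩
    ∏ (replicate n z)                    ≈⟨ ∏-replicate n ⟩
    z ^ n                                ∎

  -- Multiplication by z permutes the field; replacing 0# by 1# makes the product P of all
  -- elements cancellable, and comparing P with the product of the z x gives z ^ (q - 1) = 1.
  fermat : ∀ {z} → ¬ z ≈ 0# → z ^ (q ∸ 1) ≈ 1#
  fermat {z} z≉0 = begin
    z ^ (q ∸ 1)        ≈⟨ ∏-constant-but-one q (factor ∘ enum) (index 0#) z factor-at-0 factor-elsewhere ⟨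
    ∏ (factor ∘ enum)  ≈⟨ *-cancelʳ ∏factor*P≈P ⟩
    1#                 ∎
    where
    orOne : Carrier → Carrier
    orOne x with x ≟ 0#
    ... | yes _ = 1#
    ... | no  _ = x
    factor : Carrier → Carrier
    factor x with x ≟ 0#
    ... | yes _ = 1#
    ... | no  _ = z
    P : Carrier
    P = ∏ (orOne ∘ enum)
    orOne-cong : ∀ {x y} → x ≈ y → orOne x ≈ orOne y
    orOne-cong {x} {y} x≈y with x ≟ 0# | y ≟ 0#
    ... | yes _   | yes _   = refl
    ... | yes x≈0 | no  y≉0 = ⊥-elim (y≉0 (trans (sym x≈y) x≈0))
    ... | no  x≉0 | yes y≈0 = ⊥-elim (x≉0 (trans x≈y y≈0))
    ... | no  _   | no  _   = x≈y
    orOne-nonZero : ∀ x → ¬ orOne x ≈ 0#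
    orOne-nonZero x with x ≟ 0#
    ... | yes _   = 1≉0
    ... | no  x≉0 = x≉0
    orOne-* : ∀ x → orOne (z * x) ≈ factor x * orOne x
    orOne-* x with x ≟ 0# | z * x ≟ 0#
    ... | yes _   | yes _    = sym (*-identityˡ 1#)
    ... | yes x≈0 | no  zx≉0 = ⊥-elim (zx≉0 (trans (*-congˡ x≈0) (zeroʳ z)))
    ... | no  x≉0 | yes zx≈0 = ⊥-elim (*-nonZero z≉0 x≉0 zx≈0)
    ... | no  _   | no  _    = refl
    factor-at-0 : factor (enum (index 0#)) ≈ 1#
    factor-at-0 with enum (index 0#) ≟ 0#
    ... | yes _   = refl
    ... | no  ≉0  = ⊥-elim (≉0 (enum-index 0#))
    factor-elsewhere : ∀ j → j ≢ index 0# → factor (enum j) ≈ z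
    factor-elsewhere j j≢0 with enum j ≟ 0#
    ... | yes ≈0 = ⊥-elim (j≢0 (enum-injective _ _ (trans ≈0 (sym (enum-index 0#)))))
    ... | no  _  = refl
    cancel : ∀ {a b} → a * b ≈ 1# → ∀ x → b * (a * x) ≈ x
    cancel {a} {b} ab≈1 x = trans (sym (*-assoc b a x)) (trans (*-congʳ (trans (*-comm b a) ab≈1)) (*-identityˡ x))
    ∏factor*P≈P : ∏ (factor ∘ enum) * P ≈ 1# * P
    ∏factor*P≈P = begin
      ∏ (factor ∘ enum) * P                       ≈⟨ ∏-distrib-* (factor ∘ enum) (orOne ∘ enum) ⟨
      ∏ (λ i → factor (enum i) * orOne (enum i))  ≈⟨ ∏-cong {q} (λ i → orOne-* (enum i)) ⟨
      ∏ (orOne ∘ (z *_) ∘ enum)                   ≈⟨ sum-reindex *-commutativeMonoid orOne orOne-cong (z *_) (z ⁻¹ *_)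
                                                       *-congˡ *-congˡ (cancel (trans (*-comm _ _) (x*x⁻¹≈1 z≉0)))
                                                       (cancel (x*x⁻¹≈1 z≉0)) ⟨
      P                                           ≈⟨ *-identityˡ P ⟨
      1# * P                                      ∎
    *-cancelʳ : ∀ {x} → x * P ≈ 1# * P → x ≈ 1#
    *-cancelʳ {x} eq = *-cancelˡ-nonZero P x 1# (∏-nonZero q (orOne ∘ enum) (orOne-nonZero ∘ enum))
      (trans (*-comm P x) (trans eq (*-comm 1# P)))

  ×1-homo-^ : ∀ m n → (m ℕ.^ n) × 1# ≈ (m × 1#) ^ n
  ×1-homo-^ m zero    = +-identityʳ 1#
  ×1-homo-^ m (suc n) = trans (×1-homo-* m (m ℕ.^ n)) (*-congˡ (×1-homo-^ m n))

  p×1≈0 : ∀ {p s} → q ≡ p ℕ.^ s → p × 1# ≈ 0#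
  p×1≈0 {p} {s} q≡pˢ with p × 1# ≟ 0#
  ... | yes p×1≈0′ = p×1≈0′
  ... | no  p×1≉0  = ⊥-elim (^-nonZero s p×1≉0 (begin
    (p × 1#) ^ s       ≈⟨ ×1-homo-^ p s ⟨
    (p ℕ.^ s) × 1#     ≡⟨ ≡.cong (_× 1#) q≡pˢ ⟨
    q × 1#             ≈⟨ q×1≈0 ⟩
    0#                 ∎))

  multiple×1≈0 : ∀ a {b} → b × 1# ≈ 0# → (a ℕ.* b) × 1# ≈ 0#
  multiple×1≈0 a {b} b×1≈0 = trans (×1-homo-* a b) (trans (*-congˡ b×1≈0) (zeroʳ _))

  ×1-nonZero : ∀ {p s K} → Prime p → q ≡ p ℕ.^ s → ¬ p ∣ K → ¬ K × 1# ≈ 0#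
  ×1-nonZero {p} {s} {K} p-prime q≡pˢ p∤K K×1≈0 =
    1≉0 (bézout (coprime-Bézout (prime∤⇒coprime p-prime p∤K)))
    where
    1+ab≡cd⇒1≈0 : ∀ {a b c d} → 1 ℕ.+ a ℕ.* b ≡ c ℕ.* d → b × 1# ≈ 0# → d × 1# ≈ 0# → 1# ≈ 0#
    1+ab≡cd⇒1≈0 {a} {b} {c} {d} eq b×1≈0 d×1≈0 = begin
      1#                       ≈⟨ +-identityʳ 1# ⟨
      1# + 0#                  ≈⟨ +-congˡ (multiple×1≈0 a b×1≈0) ⟨
      (1 ℕ.+ a ℕ.* b) × 1#     ≡⟨ ≡.cong (_× 1#) eq ⟩
      (c ℕ.* d) × 1#           ≈⟨ multiple×1≈0 c d×1≈0 ⟩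
      0#                       ∎
    bézout : Bézout.Identity 1 p K → 1# ≈ 0#
    bézout (Bézout.+- x y 1+yK≡xp) = 1+ab≡cd⇒1≈0 {y} {K} {x} {p} 1+yK≡xp K×1≈0 (p×1≈0 {p} {s} q≡pˢ)
    bézout (Bézout.-+ x y 1+xp≡yK) = 1+ab≡cd⇒1≈0 {x} {p} {y} {K} 1+xp≡yK (p×1≈0 {p} {s} q≡pˢ) K×1≈0

  dividedDifference : ∀ L (a : Fin (suc L) → Carrier) → (∀ i j → i ≢ j → ¬ a i ≈ a j) →
    Σ (Fin (suc L) → Carrier) (IsDividedDifference L a)
  dividedDifference zero    a _ = (λ _ → 1#) , record
    { moment-below = λ _ _ ()
    ; moment-top   = λ b → trans (+-identityʳ _) (*-identityˡ 1#)
    }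
  dividedDifference (suc L) a distinct = w , record
    { moment-below = λ b k k<1+L → below b k (ℕ.≤-pred k<1+L)
    ; moment-top   = top
    }
    where
    α : Carrier
    α = a zero
    rest : Σ (Fin (suc L) → Carrier) (IsDividedDifference L (a ∘ suc))
    rest = dividedDifference L (a ∘ suc) (λ i j i≢j → distinct (suc i) (suc j) (i≢j ∘ suc-injective))
    w′ : Fin (suc L) → Carrier
    w′ = proj₁ rest
    open IsDividedDifference (proj₂ rest) renaming (moment-below to below′; moment-top to top′)
    gap : Fin (suc L) → Carrier
    gap i = a (suc i) - α
    gap≉0 : ∀ i → ¬ gap i ≈ 0#
    gap≉0 i gap≈0 = distinct (suc i) zero (λ ()) (x∙y⁻¹≈ε⇒x≈y _ _ gap≈0)
    w : Fin (suc (suc L)) → Carrier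
    w zero    = - ∑ (λ i → w′ i * gap i ⁻¹)
    w (suc i) = w′ i * gap i ⁻¹
    w*gap≈w′ : ∀ i → w (suc i) * gap i ≈ w′ i
    w*gap≈w′ i = trans (*-assoc _ _ _)
      (trans (*-congˡ (trans (*-comm _ _) (x*x⁻¹≈1 (gap≉0 i)))) (*-identityʳ _))
    -- Write b + aᵢ = (b + α) + (aᵢ - α); the node α contributes nothing to the second part.
    moment-suc : ∀ b k → moment a w b (suc k) ≈ (b + α) * moment a w b k + moment (a ∘ suc) w′ b k
    moment-suc b k = begin
      moment a w b (suc k)
        ≈⟨ sum-cong {suc (suc L)} split ⟩
      ∑ (λ i → (b + α) * (w i * u i ^ k) + w i * (a i - α) * u i ^ k)
        ≈⟨ ∑-distrib-+ (λ i → (b + α) * (w i * u i ^ k)) (λ i → w i * (a i - α) * u i ^ k) ⟩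
      ∑ (λ i → (b + α) * (w i * u i ^ k)) + ∑ (λ i → w i * (a i - α) * u i ^ k)
        ≈⟨ +-cong (sym (*-distribˡ-sum (b + α) (λ i → w i * u i ^ k))) (+-cong α-term (sum-cong {suc L} shifted)) ⟩
      (b + α) * moment a w b k + (0# + moment (a ∘ suc) w′ b k)
        ≈⟨ +-congˡ (+-identityˡ _) ⟩
      (b + α) * moment a w b k + moment (a ∘ suc) w′ b k
        ∎
      where
      u : Fin (suc (suc L)) → Carrier
      u i = b + a i
      a≈α+gap : ∀ i → b + a i ≈ (b + α) + (a i - α)
      a≈α+gap i = trans (+-congˡ (sym (trans (sym (+-assoc α (a i) (- α))) (xyx⁻¹≈y α (a i)))))
                        (sym (+-assoc b α (a i - α)))
      split : ∀ i → w i * u i ^ suc k ≈ (b + α) * (w i * u i ^ k) + w i * (a i - α) * u i ^ k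
      split i = begin
        w i * (u i * u i ^ k)                          ≈⟨ *-congˡ (*-congʳ (a≈α+gap i)) ⟩
        w i * (((b + α) + (a i - α)) * u i ^ k)        ≈⟨ solve 4 (λ w B D P → w :* ((B :+ D) :* P)
                                                                          := B :* (w :* P) :+ w :* D :* P)
                                                             refl (w i) (b + α) (a i - α) (u i ^ k) ⟩
        (b + α) * (w i * u i ^ k) + w i * (a i - α) * u i ^ k  ∎
      α-term : w zero * (α - α) * (b + α) ^ k ≈ 0#
      α-term = trans (*-congʳ (trans (*-congˡ (-‿inverseʳ α)) (zeroʳ _))) (zeroˡ _)
      shifted : ∀ i → w (suc i) * gap i * u (suc i) ^ k ≈ w′ i * u (suc i) ^ k
      shifted i = *-congʳ (w*gap≈w′ i)
    below : ∀ b k → k ≤ L → moment a w b k ≈ 0#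
    below b zero    _   = trans (sum-cong {suc (suc L)} (λ i → *-identityʳ (w i))) (-‿inverseˡ _)
    below b (suc k) k<L = begin
      moment a w b (suc k)                                 ≈⟨ moment-suc b k ⟩
      (b + α) * moment a w b k + moment (a ∘ suc) w′ b k   ≈⟨ +-cong (*-congˡ (below b k (ℕ.<⇒≤ k<L))) (below′ b k k<L) ⟩
      (b + α) * 0# + 0#                                    ≈⟨ trans (+-identityʳ _) (zeroʳ _) ⟩
      0#                                                   ∎
    top : ∀ b → moment a w b (suc L) ≈ 1#
    top b = begin
      moment a w b (suc L)                                 ≈⟨ moment-suc b L ⟩
      (b + α) * moment a w b L + moment (a ∘ suc) w′ b L   ≈⟨ +-cong (*-congˡ (below b L ℕ.≤-refl)) (top′ b) ⟩
      (b + α) * 0# + 1#                                    ≈⟨ trans (+-congʳ (zeroʳ _)) (+-identityˡ 1#) ⟩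
      1#                                                   ∎

order : ℕ → ℕ → ℕ → ℕ
order L zero    i       = suc L
order L (suc t) zero    = L
order L (suc t) (suc i) = order L t i

order-node : ∀ L {t i} → i < t → order L t i ≡ L
order-node L {suc t} {zero}  _         = ≡.refl
order-node L {suc t} {suc i} (s≤s i<t) = order-node L i<t

order-off-node : ∀ L {t i} → t ≤ i → order L t i ≡ suc L
order-off-node L {zero}          _         = ≡.refl
order-off-node L {suc t} {suc i} (s≤s t≤i) = order-off-node L t≤i

∑-order+t : ∀ L N {t} → t ≤ N → ∑ℕ (λ (k : Fin N) → order L t (Fin.toℕ k)) ℕ.+ t ≡ N ℕ.* suc L
∑-order+t L zero    z≤n       = ≡.refl
∑-order+t L (suc N) {zero} z≤n = begin
  (suc L ℕ.+ S) ℕ.+ 0   ≡⟨ ℕ.+-assoc (suc L) S 0 ⟩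
  suc L ℕ.+ (S ℕ.+ 0)   ≡⟨ ≡.cong (suc L ℕ.+_) (∑-order+t L N z≤n) ⟩
  suc L ℕ.+ N ℕ.* suc L ∎
  where
  open ≡.≡-Reasoning
  S : ℕ
  S = ∑ℕ (λ (k : Fin N) → order L 0 (Fin.toℕ k))
∑-order+t L (suc N) {suc t} (s≤s t≤N) = begin
  (L ℕ.+ S) ℕ.+ suc t     ≡⟨ ℕ.+-suc (L ℕ.+ S) t ⟩
  suc ((L ℕ.+ S) ℕ.+ t)   ≡⟨ ≡.cong suc (ℕ.+-assoc L S t) ⟩
  suc (L ℕ.+ (S ℕ.+ t))   ≡⟨ ≡.cong (λ x → suc (L ℕ.+ x)) (∑-order+t L N t≤N) ⟩
  suc L ℕ.+ N ℕ.* suc L   ∎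
  where
  open ≡.≡-Reasoning
  S : ℕ
  S = ∑ℕ (λ (k : Fin N) → order L t (Fin.toℕ k))

∑-order : ∀ L N → suc L ≤ N → ∑ℕ (λ (k : Fin N) → order L (suc L) (Fin.toℕ k)) ≡ (N ∸ 1) ℕ.* suc L
∑-order L N n≤N = begin
  S                                  ≡⟨ ℕ.m+n∸n≡m S (suc L) ⟨
  S ℕ.+ suc L ∸ suc L                ≡⟨ ≡.cong (_∸ suc L) (∑-order+t L N n≤N) ⟩
  N ℕ.* suc L ∸ suc L                ≡⟨ ≡.cong (N ℕ.* suc L ∸_) (ℕ.*-identityˡ (suc L)) ⟨
  N ℕ.* suc L ∸ 1 ℕ.* suc L          ≡⟨ ℕ.*-distribʳ-∸ (suc L) N 1 ⟨
  (N ∸ 1) ℕ.* suc L                  ∎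
  where
  open ≡.≡-Reasoning
  S : ℕ
  S = ∑ℕ (λ (k : Fin N) → order L (suc L) (Fin.toℕ k))

module CliqueBound {q} (F : FiniteField q) where
  open FiniteField F hiding (zero)
  open FiniteFieldFacts F
  open TaylorExpansion commRing
  open StepanovPolynomial commRing
  open import Algebra.Properties.Semiring.Exp semiring using (_^_; ^-congˡ; ^-assocʳ)
  open import Algebra.Properties.Group +-group using (⁻¹-injective; x∙y⁻¹≈ε⇒x≈y)
  open import Relation.Binary.Reasoning.Setoid setoid

  pow≡^ : ∀ x n → pow F x n ≡ x ^ n
  pow≡^ x zero    = ≡.refl
  pow≡^ x (suc n) = ≡.cong (x *_) (pow≡^ x n)

  adjacent⇒^≈1 : ∀ {d m x y} → 0 < d → d ℕ.* m ≡ q ∸ 1 → GPAdj F d x y → (- y + x) ^ m ≈ 1#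
  adjacent⇒^≈1 {d} {m} {x} {y} 0<d dm≡q-1 (x≉y , z , x-y≈zᵈ) = begin
    (- y + x) ^ m     ≈⟨ ^-congˡ m (trans (+-comm (- y) x) (trans x-y≈zᵈ (reflexive (pow≡^ z d)))) ⟩
    (z ^ d) ^ m       ≈⟨ ^-assocʳ z d m ⟩
    z ^ (d ℕ.* m)     ≡⟨ ≡.cong (z ^_) dm≡q-1 ⟩
    z ^ (q ∸ 1)       ≈⟨ fermat z≉0 ⟩
    1#                ∎
    where
    z≉0 : ¬ z ≈ 0#
    z≉0 z≈0 = x≉y (x∙y⁻¹≈ε⇒x≈y x y (trans x-y≈zᵈ (trans (reflexive (pow≡^ z d)) (^-zero z≈0 0<d))))

  clique-bound : ∀ {p s d m N L} → Prime p → q ≡ p ℕ.^ s → 0 < d → d ℕ.* m ≡ q ∸ 1 → 0 < m →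
    (v : Fin N → Carrier) → IsClique F d N v → suc L ≤ N → 0 < L → ¬ p ∣ ((L ℕ.+ m) C m) →
    (N ∸ 1) ℕ.* suc L ≤ m
  clique-bound {p} {s} {d} {m} {N} {L} p-prime q≡pˢ 0<d dm≡q-1 0<m v clique n≤N 0<L p∤binom =
    ≡.subst (_≤ m) (∑-order L N n≤N)
      (∑-orders≤degree *-cancelˡ-nonZero N (λ k → - v k) orders f distinct degree vanishes)
    where
    node : Fin (suc L) → Fin N
    node i = Fin.inject≤ i n≤N
    node< : ∀ i → Fin.toℕ (node i) < suc L
    node< i = ≡.subst (_< suc L) (≡.sym (toℕ-inject≤ i n≤N)) (toℕ<n i)
    a : Fin (suc L) → Carrier
    a = v ∘ node
    v-injective : ∀ i j → i ≢ j → ¬ v i ≈ v j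
    v-injective i j i≢j = proj₁ (clique i j i≢j)
    weights : Σ (Fin (suc L) → Carrier) (IsDividedDifference L a)
    weights = dividedDifference L a
      (λ i j i≢j → v-injective (node i) (node j) (i≢j ∘ inject≤-injective n≤N n≤N i j))
    dd : IsDividedDifference L a (proj₁ weights)
    dd = proj₂ weights
    f : Poly
    f = stepanovPoly dd m
    degree : HasDegree m f
    degree = stepanovPoly-degree dd m 0<L 0<m (×1-nonZero {s = s} p-prime q≡pˢ p∤binom)
    orders : Fin N → ℕ
    orders k = order L (suc L) (Fin.toℕ k)
    distinct : ∀ i j → i ≢ j → ¬ - v i ≈ - v j
    distinct i j i≢j = v-injective i j i≢j ∘ ⁻¹-injective
    adjacent : ∀ k i → node i ≢ k → (- v k + a i) ^ m ≈ 1#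
    adjacent k i node≢k = adjacent⇒^≈1 0<d dm≡q-1 (clique (node i) k node≢k)
    vanishes : ∀ k → VanishesToOrder (orders k) (- v k) f
    vanishes k with Fin.toℕ k ℕ.<? suc L
    ... | yes k<n = ≡.subst (λ o → VanishesToOrder o (- v k) f) (≡.sym (order-node L k<n))
      (stepanovPoly-vanishes-at-node dd m node-or-adjacent)
      where
      node-or-adjacent : ∀ i → (- v k + a i) ^ m ≈ 1# ⊎ - v k + a i ≈ 0#
      node-or-adjacent i with node i Fin.≟ k
      ... | yes node≡k = inj₂ (trans (+-congˡ (reflexive (≡.cong v node≡k))) (-‿inverseˡ (v k)))
      ... | no  node≢k = inj₁ (adjacent k i node≢k)
    ... | no  k≮n = ≡.subst (λ o → VanishesToOrder o (- v k) f) (≡.sym (order-off-node L (ℕ.≮⇒≥ k≮n)))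
      (stepanovPoly-vanishes-off-nodes dd m (λ i → adjacent k i (k≮n ∘ node≡⇒<)))
      where
      node≡⇒< : ∀ {i} → node i ≡ k → Fin.toℕ k < suc L
      node≡⇒< {i} node≡k = ≡.subst (_< suc L) (≡.cong Fin.toℕ node≡k) (node< i)

open import Data.Nat using (_+_; _*_; _^_)

prime^s>1 : ∀ {p s} → Prime p → 1 ≤ s → 1 < p ^ s
prime^s>1 {p} {suc s} p-prime _ = ℕ.<-≤-trans (ℕ.nonTrivial⇒n>1 p {{prime⇒nonTrivial p-prime}})
  (ℕ.m≤m*n p (p ^ s) {{ℕ.m^n≢0 p s {{prime⇒nonZero p-prime}}}})

theorem5p8 : (p s q d : ℕ) → .{{_ : NonZero d}} → (F : FiniteField q) →
    Prime p → ¬ (2 ∣ p) → 1 ≤ s → q ≡ p ^ s →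
    1 < d → (2 * d) ∣ (q ∸ 1) →
    (N : ℕ) → IsCliqueNumber F d N →
    (n : ℕ) → 2 ≤ n → n ≤ N →
    ¬ (p ∣ ((n ∸ 1 + (q ∸ 1) / d) C ((q ∸ 1) / d))) →
    (N ∸ 1) * n ≤ (q ∸ 1) / d
theorem5p8 p s q d F p-prime _ 1≤s q≡pˢ _ 2d∣q-1 N ((v , clique) , _) (suc L) (s≤s 0<L) n≤N p∤binom =
  CliqueBound.clique-bound F {s = s} p-prime q≡pˢ (ℕ.>-nonZero⁻¹ d) d*m≡q-1 0<m v clique n≤N 0<L p∤binom
  where
  d*m≡q-1 : d * ((q ∸ 1) / d) ≡ q ∸ 1
  d*m≡q-1 = m*[n/m]≡n (∣-trans (n∣m*n 2) 2d∣q-1)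
  0<m : 0 < (q ∸ 1) / d
  0<m with (q ∸ 1) / d | d*m≡q-1
  ... | suc _ | _       = s≤s z≤n
  ... | zero  | d*0≡q-1 = ⊥-elim (ℕ.<-irrefl (≡.trans (≡.sym (ℕ.*-zeroʳ d)) d*0≡q-1)
                                             (ℕ.m<n⇒0<n∸m (≡.subst (1 <_) (≡.sym q≡pˢ) (prime^s>1 p-prime 1≤s))))
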